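{- If $G$ is a connected $n$-vertex graph with $\Delta(G)\le 2$ that is not isomorphic to any of $P_3$, $C_3$, $C_6$, $C_7$, $C_{11}$, then $\iota(G,P_3)\le n/4$.
   Context: All graphs are finite and simple. For $D\subseteq V(G)$, $N[D]$ denotes the closed neighbourhood of $D$. A set $D\subseteq V(G)$ is a $P_3$-isolating set of $G$ if $G-N[D]$ contains no copy of the $3$-vertex path $P_3$; $\iota(G,P_3)$ is the minimum size of such a set. $C_k$ denotes the $k$-vertex cycle and $\Delta(G)$ the maximum degree. -}

module Defs where

open import Data.Nat using (ℕ; zero; suc; _+_; _*_; _≤_; _≡ᵇ_)
open import Data.Bool using (Bool; true; false; _∨_; _∧_; T)
open import Data.Fin using (Fin; toℕ)
open import Data.List using (List; length; filterᵇ; allFin)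
open import Data.Fin.Subset using (Subset; _∈_; _∉_; ∣_∣)
open import Data.Product using (Σ; ∃; _×_; _,_)
open import Relation.Binary.PropositionalEquality using (_≡_)
open import Relation.Binary.Construct.Closure.ReflexiveTransitive using (Star)
open import Relation.Nullary using (¬_)
open import Function.Bundles using (_⤖_; Bijection)

record Graph (n : ℕ) : Set where
  field
    adj    : Fin n → Fin n → Bool
    sym    : ∀ u v → adj u v ≡ adj v u
    irrefl : ∀ v → adj v v ≡ false
open Graph public

Adj : ∀ {n} → Graph n → Fin n → Fin n → Set
Adj G u v = T (adj G u v)

degree : ∀ {n} → Graph n → Fin n → ℕ
degree {n} G v = length (filterᵇ (adj G v) (allFin n))

MaxDegree≤ : ∀ {n} → Graph n → ℕ → Set
MaxDegree≤ G k = ∀ v → degree G v ≤ k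

Connected : ∀ {n} → Graph n → Set
Connected G = ∀ u v → Star (Adj G) u v

IsoTo : ∀ {n} → Graph n → (m : ℕ) → (Fin m → Fin m → Bool) → Set
IsoTo {n} G m h =
  Σ (Fin n ⤖ Fin m) λ f →
    ∀ u v → adj G u v ≡ h (Bijection.to f u) (Bijection.to f v)

pathAdj : (k : ℕ) → Fin k → Fin k → Bool
pathAdj k i j = (suc (toℕ i) ≡ᵇ toℕ j) ∨ (suc (toℕ j) ≡ᵇ toℕ i)

cycleAdj : (k : ℕ) → Fin k → Fin k → Bool
cycleAdj k i j = pathAdj k i j
  ∨ ((toℕ i ≡ᵇ 0) ∧ (suc (toℕ j) ≡ᵇ k))
  ∨ ((toℕ j ≡ᵇ 0) ∧ (suc (toℕ i) ≡ᵇ k))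

InClosedNbhd : ∀ {n} → Graph n → Subset n → Fin n → Set
InClosedNbhd G D v = v ∈ D ⊎' ∃ λ d → d ∈ D × Adj G d v
  where
  open import Data.Sum using () renaming (_⊎_ to _⊎'_)

-- D is P3-isolating: G - N[D] contains no (not necessarily induced) copy of P3,
-- i.e. no path a - b - c on three distinct vertices all outside N[D].
P3Isolating : ∀ {n} → Graph n → Subset n → Set
P3Isolating G D =
  ¬ (∃ λ a → ∃ λ b → ∃ λ c →
       ¬ InClosedNbhd G D a × ¬ InClosedNbhd G D b × ¬ InClosedNbhd G D c ×
       Adj G a b × Adj G b c × ¬ (a ≡ c))

-- A connected graph of maximum degree at most 2 is a path or a cycle. Take a path that cannot
-- be extended at either end: an interior vertex already has both of its neighbours on the path,
-- so the path is closed under adjacency and, by connectivity, contains every vertex; for the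
-- same reason its only possible chord joins its two ends. Along this numbering of the vertices
-- take the fourth vertex of every block of five as a centre. Outside the closed neighbourhoods
-- of the centres only runs of at most two consecutive vertices remain, so no P₃ survives, and
-- there is at most one centre for every four vertices. On a cycle one further centre, at
-- position 1, covers the wrap-around edge; the count then fails only for C₃, C₆, C₇ and C₁₁,
-- and on a path only for P₃.

{-# OPTIONS --safe #-}
module Submission where

open import Defs
  using (Graph; adj; Adj; degree; MaxDegree≤; Connected; IsoTo; pathAdj; cycleAdj; InClosedNbhd; P3Isolating)
open import Data.Bool using (Bool; true; false; T; _∨_; _∧_)
open import Data.Bool.Properties using (T-∨; T-∧)
open import Data.Fin using (Fin; zero; suc; toℕ; fromℕ<; _≟_)
open import Data.Fin.Properties using (injective⇒≤; toℕ-injective; toℕ<n; toℕ-fromℕ<; any?)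
open import Data.Fin.Subset using (Subset; ⁅_⁆; _∪_; ∣_∣; outside; inside) renaming (_∈_ to _∈ₛ_; ⊥ to ∅)
open import Data.Fin.Subset.Properties using (x∈⁅x⁆; x∈p∪q⁺; ∣⁅x⁆∣≡1; ∣⊥∣≡0)
open import Data.List using (List; []; _∷_; length; lookup; map; filterᵇ; allFin)
open import Data.List.Properties using (length-map)
open import Data.List.Membership.Propositional using (_∈_; _∉_; find)
open import Data.List.Membership.Propositional.Properties using (∈-allFin; ∈-filter⁺; ∈-map⁺)
open import Data.List.Relation.Unary.Any using (Any; here; there; index)
open import Data.List.Relation.Unary.Any.Properties using (lookup-index)
open import Data.Nat using (ℕ; zero; suc; _+_; _*_; _∸_; _≤_; _<_; z≤n; s≤s; _≡ᵇ_; _<?_)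
open import Data.Nat.Properties
  using ( ≡ᵇ⇒≡; ≡⇒≡ᵇ; suc-injective; +-suc; +-comm; +-identityʳ; *-comm; +-∸-assoc; m∸n≤m; m∸[m∸n]≡n
        ; n∸n≡0; ∸-cancelˡ-≡; ≤-refl; ≤-reflexive; ≤-trans; ≤-antisym; ≤-pred; <⇒≤; <⇒≱; ≮⇒≥; n≤1+n
        ; m≤m+n; m≤n+m; *-monoʳ-≤; anyUpTo?; +-commutativeSemigroup; module ≤-Reasoning )
open import Algebra.Properties.CommutativeSemigroup +-commutativeSemigroup using (x∙yz≈y∙xz)
open import Data.Product using (∃; _×_; _,_; proj₁; proj₂)
open import Data.Sum using (_⊎_; inj₁; inj₂)
import Data.Sum as Sum
open import Data.Vec using (_∷_; [])
import Data.Vec as Vec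
open import Function using (_∘_; id; _⇔_; mk⇔; Injective; Surjective; Equivalence)
open import Function.Bundles using (mk⤖; Bijection)
open import Relation.Binary.PropositionalEquality
  using (_≡_; _≢_; refl; sym; trans; cong; cong₂; subst; module ≡-Reasoning)
open import Relation.Binary.Construct.Closure.ReflexiveTransitive using (Star; ε; _◅_)
open import Relation.Nullary using (¬_; Dec; yes; no; contradiction)
open import Relation.Nullary.Decidable using (decidable-stable; map′; ¬?; _×-dec_; T?)

injective∈⇒≤length : ∀ {A : Set} {m} {xs : List A} (f : Fin m → A) →
  Injective _≡_ _≡_ f → (∀ i → f i ∈ xs) → m ≤ length xs
injective∈⇒≤length {xs = xs} f f-injective f∈xs = injective⇒≤ index∘f∈xs-injective
  where
  open ≡-Reasoning
  index∘f∈xs-injective : Injective _≡_ _≡_ (index ∘ f∈xs)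
  index∘f∈xs-injective {i} {j} eq = f-injective (begin
    f i                        ≡⟨ lookup-index (f∈xs i) ⟩
    lookup xs (index (f∈xs i)) ≡⟨ cong (lookup xs) eq ⟩
    lookup xs (index (f∈xs j)) ≡⟨ lookup-index (f∈xs j) ⟨
    f j                        ∎)

triple-injective : ∀ {A : Set} {a b c : A} → a ≢ b → a ≢ c → b ≢ c →
  Injective _≡_ _≡_ (Vec.lookup (a ∷ b ∷ c ∷ []))
triple-injective _   _   _   {zero}           {zero}           _  = refl
triple-injective _   _   _   {suc zero}       {suc zero}       _  = refl
triple-injective _   _   _   {suc (suc zero)} {suc (suc zero)} _  = refl
triple-injective a≢b _   _   {zero}           {suc zero}       eq = contradiction eq a≢b
triple-injective _   a≢c _   {zero}           {suc (suc zero)} eq = contradiction eq a≢c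
triple-injective a≢b _   _   {suc zero}       {zero}           eq = contradiction (sym eq) a≢b
triple-injective _   _   b≢c {suc zero}       {suc (suc zero)} eq = contradiction eq b≢c
triple-injective _   a≢c _   {suc (suc zero)} {zero}           eq = contradiction (sym eq) a≢c
triple-injective _   _   b≢c {suc (suc zero)} {suc zero}       eq = contradiction (sym eq) b≢c

T-injective : ∀ {x y} → (T x → T y) → (T y → T x) → x ≡ y
T-injective {false} {false} _   _   = refl
T-injective {false} {true}  _   y⇒x = contradiction (y⇒x _) λ ()
T-injective {true}  {false} x⇒y _   = contradiction (x⇒y _) λ ()
T-injective {true}  {true}  _   _   = refl

∣p∪q∣≤∣p∣+∣q∣ : ∀ {n} (p q : Subset n) → ∣ p ∪ q ∣ ≤ ∣ p ∣ + ∣ q ∣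
∣p∪q∣≤∣p∣+∣q∣ []            []            = z≤n
∣p∪q∣≤∣p∣+∣q∣ (inside ∷ p)  (inside ∷ q)  =
  s≤s (≤-trans (∣p∪q∣≤∣p∣+∣q∣ p q) (≤-trans (n≤1+n _) (≤-reflexive (sym (+-suc ∣ p ∣ ∣ q ∣)))))
∣p∪q∣≤∣p∣+∣q∣ (inside ∷ p)  (outside ∷ q) = s≤s (∣p∪q∣≤∣p∣+∣q∣ p q)
∣p∪q∣≤∣p∣+∣q∣ (outside ∷ p) (inside ∷ q)  =
  ≤-trans (s≤s (∣p∪q∣≤∣p∣+∣q∣ p q)) (≤-reflexive (sym (+-suc ∣ p ∣ ∣ q ∣)))
∣p∪q∣≤∣p∣+∣q∣ (outside ∷ p) (outside ∷ q) = ∣p∪q∣≤∣p∣+∣q∣ p q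

fromList : ∀ {n} → List (Fin n) → Subset n
fromList []       = ∅
fromList (x ∷ xs) = ⁅ x ⁆ ∪ fromList xs

∣fromList∣≤length : ∀ {n} (xs : List (Fin n)) → ∣ fromList xs ∣ ≤ length xs
∣fromList∣≤length {n} []  = ≤-reflexive (∣⊥∣≡0 n)
∣fromList∣≤length (x ∷ xs) = begin
  ∣ ⁅ x ⁆ ∪ fromList xs ∣     ≤⟨ ∣p∪q∣≤∣p∣+∣q∣ ⁅ x ⁆ (fromList xs) ⟩
  ∣ ⁅ x ⁆ ∣ + ∣ fromList xs ∣ ≡⟨ cong (_+ ∣ fromList xs ∣) (∣⁅x⁆∣≡1 x) ⟩
  suc ∣ fromList xs ∣         ≤⟨ s≤s (∣fromList∣≤length xs) ⟩
  suc (length xs)             ∎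
  where open ≤-Reasoning

∈-fromList⁺ : ∀ {n} {x : Fin n} {xs} → x ∈ xs → x ∈ₛ fromList xs
∈-fromList⁺ (here refl) = x∈p∪q⁺ (inj₁ (x∈⁅x⁆ _))
∈-fromList⁺ (there x∈)  = x∈p∪q⁺ (inj₂ (∈-fromList⁺ x∈))

data LineAdj : ℕ → ℕ → Set where
  step  : ∀ {i} → LineAdj i (suc i)
  step⁻ : ∀ {i} → LineAdj (suc i) i

data RingAdj (closed : Bool) (k : ℕ) : ℕ → ℕ → Set where
  line  : ∀ {i j} → LineAdj i j → RingAdj closed k i j
  wrap  : ∀ {j} → T closed → suc j ≡ k → RingAdj closed k 0 j
  wrap⁻ : ∀ {i} → T closed → suc i ≡ k → RingAdj closed k i 0

RingAdj-sym : ∀ {closed k i j} → RingAdj closed k i j → RingAdj closed k j i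
RingAdj-sym (line step)  = line step⁻
RingAdj-sym (line step⁻) = line step
RingAdj-sym (wrap t e)   = wrap⁻ t e
RingAdj-sym (wrap⁻ t e)  = wrap t e

-- ℕ-level forms of pathAdj and cycleAdj: ringAdj false k and ringAdj true k unfold to them.
lineAdjᵇ : ℕ → ℕ → Bool
lineAdjᵇ a b = (suc a ≡ᵇ b) ∨ (suc b ≡ᵇ a)

wrapAdjᵇ : ℕ → ℕ → ℕ → Bool
wrapAdjᵇ k a b = (a ≡ᵇ 0) ∧ (suc b ≡ᵇ k)

ringAdjᵇ : Bool → ℕ → ℕ → ℕ → Bool
ringAdjᵇ false k a b = lineAdjᵇ a b
ringAdjᵇ true  k a b = lineAdjᵇ a b ∨ wrapAdjᵇ k a b ∨ wrapAdjᵇ k b a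

ringAdj : Bool → (k : ℕ) → Fin k → Fin k → Bool
ringAdj closed k i j = ringAdjᵇ closed k (toℕ i) (toℕ j)

T-lineAdjᵇ : ∀ {a b} → T (lineAdjᵇ a b) ⇔ LineAdj a b
T-lineAdjᵇ {a} {b} = mk⇔ (sound ∘ Equivalence.to T-∨) (Equivalence.from T-∨ ∘ complete)
  where
  sound : T (suc a ≡ᵇ b) ⊎ T (suc b ≡ᵇ a) → LineAdj a b
  sound (inj₁ t) = subst (LineAdj a) (≡ᵇ⇒≡ (suc a) b t) step
  sound (inj₂ t) = subst (λ x → LineAdj x b) (≡ᵇ⇒≡ (suc b) a t) step⁻
  complete : ∀ {a b} → LineAdj a b → T (suc a ≡ᵇ b) ⊎ T (suc b ≡ᵇ a)
  complete {a} step      = inj₁ (≡⇒≡ᵇ (suc a) (suc a) refl)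
  complete {b = b} step⁻ = inj₂ (≡⇒≡ᵇ (suc b) (suc b) refl)

T-wrapAdjᵇ : ∀ {k a b} → T (wrapAdjᵇ k a b) ⇔ (a ≡ 0 × suc b ≡ k)
T-wrapAdjᵇ {k} {a} {b} = mk⇔
  (λ t → let a≡0 , 1+b≡k = Equivalence.to T-∧ t in ≡ᵇ⇒≡ a 0 a≡0 , ≡ᵇ⇒≡ (suc b) k 1+b≡k)
  (λ (a≡0 , 1+b≡k) → Equivalence.from T-∧ (≡⇒≡ᵇ a 0 a≡0 , ≡⇒≡ᵇ (suc b) k 1+b≡k))

T-ringAdjᵇ : ∀ closed k a b → T (ringAdjᵇ closed k a b) ⇔ RingAdj closed k a b
T-ringAdjᵇ false k a b = mk⇔ (line ∘ Equivalence.to T-lineAdjᵇ) λ where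
  (line ab)    → Equivalence.from T-lineAdjᵇ ab
  (wrap () _)
  (wrap⁻ () _)
T-ringAdjᵇ true k a b = mk⇔ (sound ∘ Sum.map₂ (Equivalence.to T-∨) ∘ Equivalence.to T-∨)
                            (Equivalence.from T-∨ ∘ Sum.map₂ (Equivalence.from T-∨) ∘ complete)
  where
  sound : T (lineAdjᵇ a b) ⊎ T (wrapAdjᵇ k a b) ⊎ T (wrapAdjᵇ k b a) → RingAdj true k a b
  sound (inj₁ t)        = line (Equivalence.to T-lineAdjᵇ t)
  sound (inj₂ (inj₁ t)) = let a≡0 , 1+b≡k = Equivalence.to (T-wrapAdjᵇ {k} {a}) t in
    subst (λ x → RingAdj true k x b) (sym a≡0) (wrap _ 1+b≡k)
  sound (inj₂ (inj₂ t)) = let b≡0 , 1+a≡k = Equivalence.to (T-wrapAdjᵇ {k} {b}) t in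
    subst (RingAdj true k a) (sym b≡0) (wrap⁻ _ 1+a≡k)
  complete : ∀ {a b} → RingAdj true k a b → T (lineAdjᵇ a b) ⊎ T (wrapAdjᵇ k a b) ⊎ T (wrapAdjᵇ k b a)
  complete (line ab)       = inj₁ (Equivalence.from T-lineAdjᵇ ab)
  complete (wrap _ 1+b≡k)  = inj₂ (inj₁ (Equivalence.from T-wrapAdjᵇ (refl , 1+b≡k)))
  complete (wrap⁻ _ 1+a≡k) = inj₂ (inj₂ (Equivalence.from T-wrapAdjᵇ (refl , 1+a≡k)))

Dominated : List ℕ → ℕ → Set
Dominated C x = Any (λ c → c ≡ x ⊎ LineAdj c x) C

DominatesWindow : List ℕ → ℕ → Set
DominatesWindow C i = Dominated C i ⊎ Dominated C (suc i) ⊎ Dominated C (suc (suc i))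

DominatesWindow-there : ∀ {c C i} → DominatesWindow C i → DominatesWindow (c ∷ C) i
DominatesWindow-there = Sum.map there (Sum.map there there)

pathCentres : ℕ → ℕ → List ℕ
pathCentres o 3                               = 2 + o ∷ []
pathCentres o 4                               = 3 + o ∷ []
pathCentres o (suc (suc (suc (suc (suc m))))) = 3 + o ∷ pathCentres (5 + o) m
pathCentres o _                               = []

pathCentres-dominate-window : ∀ o m d → 2 + d < m → DominatesWindow (pathCentres o m) (d + o)
pathCentres-dominate-window o 3 0 _ = inj₂ (inj₂ (here (inj₁ refl)))
pathCentres-dominate-window o 4 0 _ = inj₂ (inj₂ (here (inj₂ step⁻)))
pathCentres-dominate-window o 4 1 _ = inj₂ (inj₂ (here (inj₁ refl)))
pathCentres-dominate-window o (suc (suc (suc (suc (suc m))))) 0 _ = inj₂ (inj₂ (here (inj₂ step⁻)))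
pathCentres-dominate-window o (suc (suc (suc (suc (suc m))))) 1 _ = inj₂ (inj₂ (here (inj₁ refl)))
pathCentres-dominate-window o (suc (suc (suc (suc (suc m))))) 2 _ = inj₂ (inj₁ (here (inj₁ refl)))
pathCentres-dominate-window o (suc (suc (suc (suc (suc m))))) 3 _ = inj₁ (here (inj₁ refl))
pathCentres-dominate-window o (suc (suc (suc (suc (suc m))))) 4 _ = inj₁ (here (inj₂ step))
pathCentres-dominate-window o (suc (suc (suc (suc (suc m))))) (suc (suc (suc (suc (suc d)))))
                            (s≤s (s≤s (s≤s (s≤s (s≤s 2+d<m))))) =
  DominatesWindow-there (subst (DominatesWindow (pathCentres (5 + o) m)) (x∙yz≈y∙xz d 5 o)
                               (pathCentres-dominate-window (5 + o) m d 2+d<m))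
pathCentres-dominate-window o 3 (suc d)       (s≤s (s≤s (s≤s ())))
pathCentres-dominate-window o 4 (suc (suc d)) (s≤s (s≤s (s≤s (s≤s ()))))
pathCentres-dominate-window o 0 d ()
pathCentres-dominate-window o 1 d (s≤s ())
pathCentres-dominate-window o 2 d (s≤s (s≤s ()))

pathCentres-< : ∀ o m {c} → c ∈ pathCentres o m → c < m + o
pathCentres-< o 3 (here refl) = ≤-refl
pathCentres-< o 4 (here refl) = ≤-refl
pathCentres-< o (suc (suc (suc (suc (suc m))))) (here refl) = s≤s (s≤s (s≤s (s≤s (m≤n+m o (suc m)))))
pathCentres-< o (suc (suc (suc (suc (suc m))))) {c} (there c∈) =
  subst (c <_) (x∙yz≈y∙xz m 5 o) (pathCentres-< (5 + o) m c∈)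

pathCentres-count-≤1+ : ∀ o m → length (pathCentres o m) * 4 ≤ suc m
pathCentres-count-≤1+ o 0 = z≤n
pathCentres-count-≤1+ o 1 = z≤n
pathCentres-count-≤1+ o 2 = z≤n
pathCentres-count-≤1+ o 3 = ≤-refl
pathCentres-count-≤1+ o 4 = s≤s (s≤s (s≤s (s≤s z≤n)))
pathCentres-count-≤1+ o (suc (suc (suc (suc (suc m))))) =
  s≤s (s≤s (s≤s (s≤s (≤-trans (pathCentres-count-≤1+ (5 + o) m) (n≤1+n _)))))

pathCentres-count-≤ : ∀ o m → m ≢ 3 → length (pathCentres o m) * 4 ≤ m
pathCentres-count-≤ o 0 _   = z≤n
pathCentres-count-≤ o 1 _   = z≤n
pathCentres-count-≤ o 2 _   = z≤n
pathCentres-count-≤ o 3 m≢3 = contradiction refl m≢3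
pathCentres-count-≤ o 4 _   = ≤-refl
pathCentres-count-≤ o (suc (suc (suc (suc (suc m))))) _ =
  s≤s (s≤s (s≤s (s≤s (pathCentres-count-≤1+ (5 + o) m))))

pathCentres-count-< : ∀ o m → m ≢ 0 → m ≢ 3 → m ≢ 4 → m ≢ 8 → length (pathCentres o m) * 4 < m
pathCentres-count-< o 0 m≢0 _   _   _ = contradiction refl m≢0
pathCentres-count-< o 1 _   _   _   _ = s≤s z≤n
pathCentres-count-< o 2 _   _   _   _ = s≤s z≤n
pathCentres-count-< o 3 _   m≢3 _   _ = contradiction refl m≢3
pathCentres-count-< o 4 _   _   m≢4 _ = contradiction refl m≢4
pathCentres-count-< o (suc (suc (suc (suc (suc m))))) _ _ _ m≢8 =
  s≤s (s≤s (s≤s (s≤s (s≤s (pathCentres-count-≤ (5 + o) m (m≢8 ∘ cong (5 +_)))))))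

-- On the cycle the centre 1 dominates 0, 1, 2, and with 0 the wrap-around edge {k − 1, 0};
-- the vertices 3, …, k − 1 are then treated as a path.
ringCentres : Bool → ℕ → List ℕ
ringCentres false k = pathCentres 0 k
ringCentres true  k = 1 ∷ pathCentres 3 (k ∸ 3)

ringCentres-< : ∀ closed k → 3 ≤ k → ∀ {c} → c ∈ ringCentres closed k → c < k
ringCentres-< false k _ {c} c∈ = subst (c <_) (+-identityʳ k) (pathCentres-< 0 k c∈)
ringCentres-< true _ (s≤s (s≤s (s≤s _))) (here refl) = s≤s (s≤s z≤n)
ringCentres-< true (suc (suc (suc m))) _ {c} (there c∈) = subst (c <_) (+-comm m 3) (pathCentres-< 3 m c∈)

ringCentres-dominate-window : ∀ closed k i → 2 + i < k → DominatesWindow (ringCentres closed k) i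
ringCentres-dominate-window false k i 2+i<k =
  subst (DominatesWindow (pathCentres 0 k)) (+-identityʳ i) (pathCentres-dominate-window 0 k i 2+i<k)
ringCentres-dominate-window true _ 0 (s≤s (s≤s (s≤s _))) = inj₂ (inj₁ (here (inj₁ refl)))
ringCentres-dominate-window true _ 1 (s≤s (s≤s (s≤s _))) = inj₁ (here (inj₁ refl))
ringCentres-dominate-window true _ 2 (s≤s (s≤s (s≤s _))) = inj₁ (here (inj₂ step))
ringCentres-dominate-window true (suc (suc (suc m))) (suc (suc (suc d))) (s≤s (s≤s (s≤s 2+d<m))) =
  DominatesWindow-there (subst (DominatesWindow (pathCentres 3 m)) (+-comm d 3)
                               (pathCentres-dominate-window 3 m d 2+d<m))

ringCentres-dominate-0 : ∀ {closed} k → T closed → Dominated (ringCentres closed k) 0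
ringCentres-dominate-0 {true} k _ = here (inj₂ step⁻)

ringCentres-dominate-P3 : ∀ closed k {i j l} → i < k → l < k →
  RingAdj closed k i j → RingAdj closed k j l → i ≢ l →
  let C = ringCentres closed k in Dominated C i ⊎ Dominated C j ⊎ Dominated C l
ringCentres-dominate-P3 closed k {i} _ l<k (line step) (line step) _ =
  ringCentres-dominate-window closed k i l<k
ringCentres-dominate-P3 closed k {l = l} i<k _ (line step⁻) (line step⁻) _
  with ringCentres-dominate-window closed k l i<k
... | inj₁ l-dominated        = inj₂ (inj₂ l-dominated)
... | inj₂ (inj₁ j-dominated) = inj₂ (inj₁ j-dominated)
... | inj₂ (inj₂ i-dominated) = inj₁ i-dominated
ringCentres-dominate-P3 closed k _ _ (line step)  (line step⁻) i≢l = contradiction refl i≢l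
ringCentres-dominate-P3 closed k _ _ (line step⁻) (line step)  i≢l = contradiction refl i≢l
ringCentres-dominate-P3 closed k _ _ (wrap t _)   _            _   = inj₁ (ringCentres-dominate-0 k t)
ringCentres-dominate-P3 closed k _ _ (wrap⁻ t _)  _            _   = inj₂ (inj₁ (ringCentres-dominate-0 k t))
ringCentres-dominate-P3 closed k _ _ (line _)     (wrap t _)   _   = inj₂ (inj₁ (ringCentres-dominate-0 k t))
ringCentres-dominate-P3 closed k _ _ (line _)     (wrap⁻ t _)  _   = inj₂ (inj₂ (ringCentres-dominate-0 k t))

exceptionalOrders : Bool → List ℕ
exceptionalOrders false = 3 ∷ []
exceptionalOrders true  = 3 ∷ 6 ∷ 7 ∷ 11 ∷ []

ringCentres-count : ∀ closed k → 3 ≤ k → k ∉ exceptionalOrders closed →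
                    length (ringCentres closed k) * 4 ≤ k
ringCentres-count false k _ k∉ = pathCentres-count-≤ 0 k (k∉ ∘ here)
ringCentres-count true (suc (suc (suc m))) (s≤s (s≤s (s≤s _))) k∉ = s≤s (s≤s (s≤s (pathCentres-count-< 3 m
  (k∉ ∘ here ∘ cong (3 +_))
  (k∉ ∘ there ∘ here ∘ cong (3 +_))
  (k∉ ∘ there ∘ there ∘ here ∘ cong (3 +_))
  (k∉ ∘ there ∘ there ∘ there ∘ here ∘ cong (3 +_)))))

module _ {n : ℕ} (G : Graph n) where

  Adj-sym : ∀ {u v} → Adj G u v → Adj G v u
  Adj-sym {u} {v} = subst T (Graph.sym G u v)

  Adj⇒≢ : ∀ {u v} → Adj G u v → u ≢ v
  Adj⇒≢ {u} u~u refl = subst T (Graph.irrefl G u) u~u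

  <3⇒P3Isolating : n < 3 → ∀ D → P3Isolating G D
  <3⇒P3Isolating n<3 _ (_ , _ , _ , _ , _ , _ , a~b , b~c , a≢c) =
    <⇒≱ n<3 (injective⇒≤ (triple-injective (Adj⇒≢ a~b) a≢c (Adj⇒≢ b~c)))

  enumeration⇒IsoTo : ∀ {k} {h : Fin k → Fin k → Bool} (e : Fin k → Fin n) (e⁻¹ : Fin n → Fin k) →
    Injective _≡_ _≡_ e → (∀ v → e (e⁻¹ v) ≡ v) → (∀ i j → adj G (e i) (e j) ≡ h i j) → IsoTo G k h
  enumeration⇒IsoTo {h = h} e e⁻¹ e-injective e∘e⁻¹ e-hom = mk⤖ (e⁻¹-injective , e⁻¹-surjective) , e⁻¹-hom
    where
    open ≡-Reasoning
    e⁻¹-injective : Injective _≡_ _≡_ e⁻¹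
    e⁻¹-injective {u} {v} eq = begin
      u         ≡⟨ e∘e⁻¹ u ⟨
      e (e⁻¹ u) ≡⟨ cong e eq ⟩
      e (e⁻¹ v) ≡⟨ e∘e⁻¹ v ⟩
      v         ∎
    e⁻¹-surjective : Surjective _≡_ _≡_ e⁻¹
    e⁻¹-surjective i = e i , λ { refl → e-injective (e∘e⁻¹ (e i)) }
    e⁻¹-hom : ∀ u v → adj G u v ≡ h (e⁻¹ u) (e⁻¹ v)
    e⁻¹-hom u v = begin
      adj G u v                     ≡⟨ cong₂ (adj G) (e∘e⁻¹ u) (e∘e⁻¹ v) ⟨
      adj G (e (e⁻¹ u)) (e (e⁻¹ v)) ≡⟨ e-hom (e⁻¹ u) (e⁻¹ v) ⟩
      h (e⁻¹ u) (e⁻¹ v)             ∎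

  IsoTo⇒≤ : ∀ {k h} → IsoTo G k h → n ≤ k
  IsoTo⇒≤ (f , _) = injective⇒≤ (Bijection.injective f)

exceptional⇒¬IsoTo : ∀ {n} (G : Graph n) →
  ¬ IsoTo G 3 (pathAdj 3) → ¬ IsoTo G 3 (cycleAdj 3) → ¬ IsoTo G 6 (cycleAdj 6) →
  ¬ IsoTo G 7 (cycleAdj 7) → ¬ IsoTo G 11 (cycleAdj 11) →
  ∀ closed {m} → m ∈ exceptionalOrders closed → ¬ IsoTo G m (ringAdj closed m)
exceptional⇒¬IsoTo _ ¬P₃ _   _   _   _    false (here refl)                         = ¬P₃
exceptional⇒¬IsoTo _ _   ¬C₃ _   _   _    true  (here refl)                         = ¬C₃
exceptional⇒¬IsoTo _ _   _   ¬C₆ _   _    true  (there (here refl))                 = ¬C₆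
exceptional⇒¬IsoTo _ _   _   _   ¬C₇ _    true  (there (there (here refl)))         = ¬C₇
exceptional⇒¬IsoTo _ _   _   _   _   ¬C₁₁ true  (there (there (there (here refl)))) = ¬C₁₁

data Place (m : ℕ) : ℕ → Set where
  first    : Place m 0
  final    : Place m m
  interior : ∀ {i} → suc i < m → Place m (suc i)

place : ∀ {m i} → i ≤ m → Place m i
place {i = zero} _ = first
place {m} {suc i} 1+i≤m with suc i <? m
... | yes 1+i<m = interior 1+i<m
... | no  1+i≮m = subst (Place m) (≤-antisym (≮⇒≥ 1+i≮m) 1+i≤m) final

module MaxDegreeTwo {n : ℕ} (G : Graph n) (Δ≤2 : MaxDegree≤ G 2) where

  only-two-neighbours : ∀ {u a b c} → Adj G u a → Adj G u b → a ≢ b → Adj G u c → c ≡ a ⊎ c ≡ b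
  only-two-neighbours {u} {a} {b} {c} u~a u~b a≢b u~c with c ≟ a | c ≟ b
  ... | yes c≡a | _       = inj₁ c≡a
  ... | no _    | yes c≡b = inj₂ c≡b
  ... | no c≢a  | no c≢b  = contradiction (Δ≤2 u) (<⇒≱ 3≤degree)
    where
    neighbour : ∀ i → Vec.lookup (a ∷ b ∷ c ∷ []) i ∈ filterᵇ (adj G u) (allFin n)
    neighbour zero             = ∈-filter⁺ (T? ∘ adj G u) (∈-allFin a) u~a
    neighbour (suc zero)       = ∈-filter⁺ (T? ∘ adj G u) (∈-allFin b) u~b
    neighbour (suc (suc zero)) = ∈-filter⁺ (T? ∘ adj G u) (∈-allFin c) u~c
    3≤degree : 3 ≤ degree G u
    3≤degree = injective∈⇒≤length _ (triple-injective a≢b (c≢a ∘ sym) (c≢b ∘ sym)) neighbour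

  -- The path visits vertex 0, …, vertex last; vertex is arbitrary beyond last.
  record Path : Set where
    field
      last      : ℕ
      vertex    : ℕ → Fin n
      injective : ∀ {i j} → i ≤ last → j ≤ last → vertex i ≡ vertex j → i ≡ j
      linked    : ∀ {i} → i < last → Adj G (vertex i) (vertex (suc i))

  open Path public

  size : Path → ℕ
  size P = suc (last P)

  front back : Path → Fin n
  front P = vertex P 0
  back  P = vertex P (last P)

  closed : Path → Bool
  closed P = adj G (front P) (back P)

  _∈ᴾ_ : Fin n → Path → Set
  v ∈ᴾ P = ∃ λ i → i ≤ last P × vertex P i ≡ v

  _∈ᴾ?_ : ∀ v P → Dec (v ∈ᴾ P)
  v ∈ᴾ? P = map′ (λ (i , i<size , eq) → i , ≤-pred i<size , eq)
                 (λ (i , i≤last , eq) → i , s≤s i≤last , eq)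
                 (anyUpTo? (λ i → vertex P i ≟ v) (size P))

  size≤n : ∀ P → size P ≤ n
  size≤n P = injective⇒≤ {f = vertex P ∘ toℕ} λ eq →
    toℕ-injective (injective P (≤-pred (toℕ<n _)) (≤-pred (toℕ<n _)) eq)

  singleton : Fin n → Path
  singleton v = record
    { last      = 0
    ; vertex    = λ _ → v
    ; injective = λ { z≤n z≤n _ → refl }
    ; linked    = λ ()
    }

  cons : (y : Fin n) (P : Path) → Adj G y (front P) → ¬ y ∈ᴾ P → Path
  cons y P y~front y∉P = record
    { last      = suc (last P)
    ; vertex    = vertex′
    ; injective = injective′
    ; linked    = linked′
    }
    where
    vertex′ : ℕ → Fin n
    vertex′ zero    = y
    vertex′ (suc i) = vertex P i
    injective′ : ∀ {i j} → i ≤ suc (last P) → j ≤ suc (last P) → vertex′ i ≡ vertex′ j → i ≡ j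
    injective′ {zero}  {zero}  _              _              _  = refl
    injective′ {zero}  {suc j} _              (s≤s j≤last) eq = contradiction (j , j≤last , sym eq) y∉P
    injective′ {suc i} {zero}  (s≤s i≤last) _              eq = contradiction (i , i≤last , eq) y∉P
    injective′ {suc i} {suc j} (s≤s i≤last) (s≤s j≤last) eq = cong suc (injective P i≤last j≤last eq)
    linked′ : ∀ {i} → i < suc (last P) → Adj G (vertex′ i) (vertex′ (suc i))
    linked′ {zero}  _            = y~front
    linked′ {suc i} (s≤s i<last) = linked P i<last

  ∈ᴾ-cons : ∀ y P y~front y∉P {v} → v ∈ᴾ P → v ∈ᴾ cons y P y~front y∉P
  ∈ᴾ-cons _ _ _ _ (i , i≤last , eq) = suc i , s≤s i≤last , eq

  reverse : Path → Path
  reverse P = record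
    { last      = last P
    ; vertex    = λ i → vertex P (last P ∸ i)
    ; injective = λ {i} {j} i≤last j≤last eq →
        ∸-cancelˡ-≡ i≤last j≤last (injective P (m∸n≤m (last P) i) (m∸n≤m (last P) j) eq)
    ; linked    = linked′
    }
    where
    linked′ : ∀ {i} → i < last P → Adj G (vertex P (last P ∸ i)) (vertex P (last P ∸ suc i))
    linked′ {i} i<last = Adj-sym G (subst (λ x → Adj G (vertex P (last P ∸ suc i)) (vertex P x))
      1+[last∸1+i]≡last∸i (linked P (subst (_≤ last P) (sym 1+[last∸1+i]≡last∸i) (m∸n≤m (last P) i))))
      where
      1+[last∸1+i]≡last∸i : suc (last P ∸ suc i) ≡ last P ∸ i
      1+[last∸1+i]≡last∸i = sym (+-∸-assoc 1 i<last)

  ∈ᴾ-reverse : ∀ {v P} → v ∈ᴾ P → v ∈ᴾ reverse P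
  ∈ᴾ-reverse {P = P} (i , i≤last , eq) =
    last P ∸ i , m∸n≤m (last P) i , trans (cong (vertex P) (m∸[m∸n]≡n i≤last)) eq

  FrontMaximal BackMaximal : Path → Set
  FrontMaximal P = ∀ {v} → Adj G (front P) v → v ∈ᴾ P
  BackMaximal  P = ∀ {v} → Adj G (back P) v → v ∈ᴾ P

  reverse-BackMaximal : ∀ {P} → FrontMaximal P → BackMaximal (reverse P)
  reverse-BackMaximal {P} P-front {v} back~v =
    ∈ᴾ-reverse {P = P} (P-front (subst (λ x → Adj G (vertex P x) v) (n∸n≡0 (last P)) back~v))

  -- Paths have at most n vertices, so the fuel cannot run out while an extension is possible.
  extendFront : ∀ fuel P → n ≤ fuel + last P → ∃ λ Q → FrontMaximal Q × (BackMaximal P → BackMaximal Q)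
  extendFront zero P n≤last = contradiction n≤last (<⇒≱ (size≤n P))
  extendFront (suc fuel) P n≤ with any? (λ v → T? (adj G (front P) v) ×-dec ¬? (v ∈ᴾ? P))
  ... | no cannot-extend =
    P , (λ {v} front~v → decidable-stable (v ∈ᴾ? P) λ v∉P → cannot-extend (v , front~v , v∉P)) , id
  ... | yes (y , front~y , y∉P) =
    let y~front = Adj-sym G front~y
        Q , Q-front , Q-back = extendFront fuel (cons y P y~front y∉P)
                                 (subst (n ≤_) (sym (+-suc fuel (last P))) n≤)
    in  Q , Q-front , λ P-back → Q-back (∈ᴾ-cons y P y~front y∉P ∘ P-back)

  -- Extending at the front, reversing and extending at the front again keeps the first front
  -- maximal: it is now the back, and all its neighbours are already on the path.
  maximalPath : Fin n → ∃ λ P → FrontMaximal P × BackMaximal P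
  maximalPath v =
    let P , P-front , _      = extendFront n (singleton v) (≤-reflexive (sym (+-identityʳ n)))
        Q , Q-front , Q-back = extendFront n (reverse P) (m≤m+n n (last P))
    in  Q , Q-front , Q-back (reverse-BackMaximal {P} P-front)

  module _ (P : Path) where

    interior-neighbour : ∀ {i v} → suc i < last P → Adj G (vertex P (suc i)) v →
                         v ≡ vertex P i ⊎ v ≡ vertex P (suc (suc i))
    interior-neighbour 1+i<last x~v =
      only-two-neighbours (Adj-sym G (linked P (<⇒≤ 1+i<last))) (linked P 1+i<last)
        (λ eq → contradiction (injective P (≤-trans (n≤1+n _) (<⇒≤ 1+i<last)) 1+i<last eq) λ ()) x~v

    private
      interior-RingAdj : ∀ {i j} → suc i < last P → j ≤ last P → Adj G (vertex P (suc i)) (vertex P j) →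
                         RingAdj (closed P) (size P) (suc i) j
      interior-RingAdj {i} {j} 1+i<last j≤last i~j with interior-neighbour 1+i<last i~j
      ... | inj₁ j≡i   = subst (RingAdj (closed P) (size P) (suc i))
                           (sym (injective P j≤last (≤-trans (n≤1+n _) (<⇒≤ 1+i<last)) j≡i)) (line step⁻)
      ... | inj₂ j≡2+i = subst (RingAdj (closed P) (size P) (suc i))
                           (sym (injective P j≤last 1+i<last j≡2+i)) (line step)

    Adj⇒RingAdj : ∀ {i j} → i ≤ last P → j ≤ last P → Adj G (vertex P i) (vertex P j) →
                  RingAdj (closed P) (size P) i j
    Adj⇒RingAdj i≤last j≤last i~j with place i≤last | place j≤last
    ... | interior 1+i<last | _                 = interior-RingAdj 1+i<last j≤last i~j
    ... | _                 | interior 1+j<last =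
      RingAdj-sym (interior-RingAdj 1+j<last i≤last (Adj-sym G i~j))
    ... | first             | first             = contradiction refl (Adj⇒≢ G i~j)
    ... | first             | final             = wrap i~j refl
    ... | final             | first             = wrap⁻ (Adj-sym G i~j) refl
    ... | final             | final             = contradiction refl (Adj⇒≢ G i~j)

    RingAdj⇒Adj : ∀ {i j} → i ≤ last P → j ≤ last P → RingAdj (closed P) (size P) i j →
                  Adj G (vertex P i) (vertex P j)
    RingAdj⇒Adj _      j≤last (line step)  = linked P j≤last
    RingAdj⇒Adj i≤last _      (line step⁻) = Adj-sym G (linked P i≤last)
    RingAdj⇒Adj _      _      (wrap front~back 1+j≡size) =
      subst (λ x → Adj G (front P) (vertex P x)) (sym (suc-injective 1+j≡size)) front~back
    RingAdj⇒Adj _      _      (wrap⁻ front~back 1+i≡size) =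
      Adj-sym G (subst (λ x → Adj G (front P) (vertex P x)) (sym (suc-injective 1+i≡size)) front~back)

  module Hamiltonian (conn : Connected G) (v₀ : Fin n) where

    P : Path
    P = proj₁ (maximalPath v₀)

    private
      P-front : FrontMaximal P
      P-front = proj₁ (proj₂ (maximalPath v₀))

      P-back : BackMaximal P
      P-back = proj₂ (proj₂ (maximalPath v₀))

    neighbour-∈ᴾ : ∀ {v w} → v ∈ᴾ P → Adj G v w → w ∈ᴾ P
    neighbour-∈ᴾ (i , i≤last , refl) v~w with place i≤last
    ... | first             = P-front v~w
    ... | final             = P-back v~w
    ... | interior 1+i<last = Sum.[ (λ w≡ → _ , ≤-trans (n≤1+n _) (<⇒≤ 1+i<last) , sym w≡)
                                  , (λ w≡ → _ , 1+i<last , sym w≡) ] (interior-neighbour P 1+i<last v~w)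

    all-∈ᴾ : ∀ v → v ∈ᴾ P
    all-∈ᴾ v = reachable (0 , z≤n , refl) (conn (front P) v)
      where
      reachable : ∀ {u w} → u ∈ᴾ P → Star (Adj G) u w → w ∈ᴾ P
      reachable u∈P ε           = u∈P
      reachable u∈P (u~x ◅ x⇝w) = reachable (neighbour-∈ᴾ u∈P u~x) x⇝w

    position : Fin n → Fin (size P)
    position v = fromℕ< (s≤s (proj₁ (proj₂ (all-∈ᴾ v))))

    vertex-position : ∀ v → vertex P (toℕ (position v)) ≡ v
    vertex-position v = trans (cong (vertex P) (toℕ-fromℕ< _)) (proj₂ (proj₂ (all-∈ᴾ v)))

    isomorphism : IsoTo G (size P) (ringAdj (closed P) (size P))
    isomorphism = enumeration⇒IsoTo G (vertex P ∘ toℕ) position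
      (λ eq → toℕ-injective (injective P (≤-pred (toℕ<n _)) (≤-pred (toℕ<n _)) eq))
      vertex-position
      λ i j → let i≤last = ≤-pred (toℕ<n i); j≤last = ≤-pred (toℕ<n j)
                  T-ring = T-ringAdjᵇ (closed P) (size P) (toℕ i) (toℕ j) in
        T-injective (Equivalence.from T-ring ∘ Adj⇒RingAdj P i≤last j≤last)
                    (RingAdj⇒Adj P i≤last j≤last ∘ Equivalence.to T-ring)

    n≤size : n ≤ size P
    n≤size = IsoTo⇒≤ G {h = ringAdj (closed P) (size P)} isomorphism

    Dominated⇒InClosedNbhd : ∀ {C i} → (∀ {c} → c ∈ C → c < size P) → i ≤ last P → Dominated C i →
                             InClosedNbhd G (fromList (map (vertex P) C)) (vertex P i)
    Dominated⇒InClosedNbhd C<size i≤last dominated with find dominated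
    ... | c , c∈C , inj₁ refl = inj₁ (∈-fromList⁺ (∈-map⁺ (vertex P) c∈C))
    ... | c , c∈C , inj₂ c~i  = inj₂ (vertex P c , ∈-fromList⁺ (∈-map⁺ (vertex P) c∈C) ,
                                      RingAdj⇒Adj P (≤-pred (C<size c∈C)) i≤last (line c~i))

    centres⇒P3Isolating : (C : List ℕ) → (∀ {c} → c ∈ C → c < size P) →
      (∀ {i j l} → i < size P → l < size P →
         RingAdj (closed P) (size P) i j → RingAdj (closed P) (size P) j l → i ≢ l →
         Dominated C i ⊎ Dominated C j ⊎ Dominated C l) →
      P3Isolating G (fromList (map (vertex P) C))
    centres⇒P3Isolating C C<size dominate (a , b , c , a∉ , b∉ , c∉ , a~b , b~c , a≢c)
      with all-∈ᴾ a | all-∈ᴾ b | all-∈ᴾ c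
    ... | i , i≤last , refl | j , j≤last , refl | l , l≤last , refl
      with dominate (s≤s i≤last) (s≤s l≤last)
                    (Adj⇒RingAdj P i≤last j≤last a~b) (Adj⇒RingAdj P j≤last l≤last b~c)
                    (a≢c ∘ cong (vertex P))
    ...   | inj₁ i-dominated        = a∉ (Dominated⇒InClosedNbhd C<size i≤last i-dominated)
    ...   | inj₂ (inj₁ j-dominated) = b∉ (Dominated⇒InClosedNbhd C<size j≤last j-dominated)
    ...   | inj₂ (inj₂ l-dominated) = c∉ (Dominated⇒InClosedNbhd C<size l≤last l-dominated)

lemma2p4 : ∀ (n : ℕ) (G : Graph n) → Connected G → MaxDegree≤ G 2 →
    ¬ IsoTo G 3 (pathAdj 3) → ¬ IsoTo G 3 (cycleAdj 3) → ¬ IsoTo G 6 (cycleAdj 6) →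
    ¬ IsoTo G 7 (cycleAdj 7) → ¬ IsoTo G 11 (cycleAdj 11) →
    ∃ λ (D : Subset n) → P3Isolating G D × 4 * ∣ D ∣ ≤ n
lemma2p4 n G conn Δ≤2 ¬P₃ ¬C₃ ¬C₆ ¬C₇ ¬C₁₁ with n <? 3
... | yes n<3 = ∅ , <3⇒P3Isolating G n<3 ∅ , subst (λ s → 4 * s ≤ n) (sym (∣⊥∣≡0 n)) z≤n
... | no  n≮3 = D , D-isolating , 4∣D∣≤n
  where
  open MaxDegreeTwo G Δ≤2
  open Hamiltonian conn (fromℕ< (≤-trans (s≤s z≤n) (≮⇒≥ n≮3)))

  k : ℕ
  k = size P

  C : List ℕ
  C = ringCentres (closed P) k

  D : Subset n
  D = fromList (map (vertex P) C)

  3≤k : 3 ≤ k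
  3≤k = ≤-trans (≮⇒≥ n≮3) n≤size

  D-isolating : P3Isolating G D
  D-isolating =
    centres⇒P3Isolating C (ringCentres-< (closed P) k 3≤k) (ringCentres-dominate-P3 (closed P) k)

  k∉exceptional : k ∉ exceptionalOrders (closed P)
  k∉exceptional k∈ = exceptional⇒¬IsoTo G ¬P₃ ¬C₃ ¬C₆ ¬C₇ ¬C₁₁ (closed P) k∈ isomorphism

  4∣D∣≤n : 4 * ∣ D ∣ ≤ n
  4∣D∣≤n = begin
    4 * ∣ D ∣                     ≤⟨ *-monoʳ-≤ 4 (∣fromList∣≤length (map (vertex P) C)) ⟩
    4 * length (map (vertex P) C) ≡⟨ cong (4 *_) (length-map (vertex P) C) ⟩
    4 * length C                  ≡⟨ *-comm 4 (length C) ⟩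
    length C * 4                  ≤⟨ ringCentres-count (closed P) k 3≤k k∉exceptional ⟩
    k                             ≤⟨ size≤n P ⟩
    n                             ∎
    where open ≤-Reasoning
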